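{- Let $R,C$ be positive integers, ${\cal I}=\{(i,j)\mid 1\le i\le R,\ 1\le j\le C\}$ and let $S$ be a nonempty proper subset of ${\cal I}$. Then neither $S$ nor $S^c={\cal I}\setminus S$ contains the pattern ${\cal P}$ or the pattern ${\cal P}^t$ if and only if $S$ is equivalent to a $2\times 2$ block diagonal set or $S$ is a triangular set.
   Context: For $T\in\{S,S^c\}$: $T$ contains ${\cal P}$ if there are distinct rows $i_1,i_2$ and distinct columns $j_1,j_2,j_3$ with $(i_1,j_1),(i_2,j_2)\in T$ and $(i_1,j_2),(i_2,j_1),(i_1,j_3),(i_2,j_3)\notin T$; $T$ contains ${\cal P}^t$ if there are distinct rows $i_1,i_2,i_3$ and distinct columns $j_1,j_2$ with $(i_1,j_1),(i_2,j_2)\in T$ and $(i_1,j_2),(i_2,j_1),(i_3,j_1),(i_3,j_2)\notin T$. $S$ is equivalent to a $2\times2$ block diagonal set if, after some permutation of the rows and some permutation of the columns, $S=\{(i,j)\mid i\le r,\ j\le c\}\cup\{(i,j)\mid i>r,\ j>c\}$ for some integers $0\le r<R$, $0\le c<C$. For a row $i$ let ${\cal J}(i)=\{j\mid (i,j)\in S\}$; $S$ is a triangular set if for every pair of rows $i,i'$ either ${\cal J}(i)\subseteq{\cal J}(i')$ or ${\cal J}(i')\subseteq{\cal J}(i)$. -}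

module Defs where

open import Data.Nat using (ℕ; suc; _<_; _<ᵇ_; _≤ᵇ_)
open import Data.Fin using (Fin; toℕ)
open import Data.Bool using (Bool; true; false; not; _∧_; _∨_)
open import Data.Product using (Σ; ∃; ∃-syntax; _×_; _,_)
open import Data.Sum using (_⊎_)
open import Relation.Binary.PropositionalEquality using (_≡_; _≢_)
open import Data.Fin.Permutation using (Permutation′; _⟨$⟩ʳ_)

-- A subset T of I = [R] × [C] is given by its characteristic function.
-- Rows/columns are indexed by Fin R / Fin C (0-based: row i of the paper is Fin index i-1).
SubsetI : ℕ → ℕ → Set
SubsetI R C = Fin R → Fin C → Bool

_∈T_ : ∀ {R C} → Fin R × Fin C → SubsetI R C → Set
(i , j) ∈T T = T i j ≡ true

_∉T_ : ∀ {R C} → Fin R × Fin C → SubsetI R C → Set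
(i , j) ∉T T = T i j ≡ false

compl : ∀ {R C} → SubsetI R C → SubsetI R C
compl S i j = not (S i j)

ContainsP : ∀ {R C} → SubsetI R C → Set
ContainsP {R} {C} T =
  Σ (Fin R) λ i₁ → Σ (Fin R) λ i₂ → Σ (Fin C) λ j₁ → Σ (Fin C) λ j₂ → Σ (Fin C) λ j₃ →
    i₁ ≢ i₂ × j₁ ≢ j₂ × j₁ ≢ j₃ × j₂ ≢ j₃ ×
    (i₁ , j₁) ∈T T × (i₂ , j₂) ∈T T ×
    (i₁ , j₂) ∉T T × (i₂ , j₁) ∉T T × (i₁ , j₃) ∉T T × (i₂ , j₃) ∉T T

ContainsPt : ∀ {R C} → SubsetI R C → Set
ContainsPt {R} {C} T =
  Σ (Fin R) λ i₁ → Σ (Fin R) λ i₂ → Σ (Fin R) λ i₃ → Σ (Fin C) λ j₁ → Σ (Fin C) λ j₂ →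
    i₁ ≢ i₂ × i₁ ≢ i₃ × i₂ ≢ i₃ × j₁ ≢ j₂ ×
    (i₁ , j₁) ∈T T × (i₂ , j₂) ∈T T ×
    (i₁ , j₂) ∉T T × (i₂ , j₁) ∉T T × (i₃ , j₁) ∉T T × (i₃ , j₂) ∉T T

-- The 2×2 block diagonal set with parameters r, c (0-based indices):
-- {(i,j) | i < r, j < c} ∪ {(i,j) | i ≥ r, j ≥ c}
-- (paper, 1-based: i ≤ r, j ≤ c  and  i > r, j > c).
blockDiag : ∀ {R C} → ℕ → ℕ → SubsetI R C
blockDiag r c i j = ((toℕ i <ᵇ r) ∧ (toℕ j <ᵇ c)) ∨ ((r ≤ᵇ toℕ i) ∧ (c ≤ᵇ toℕ j))

EquivBlockDiag : ∀ {R C} → SubsetI R C → Set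
EquivBlockDiag {R} {C} S =
  Σ (Permutation′ R) λ σ → Σ (Permutation′ C) λ τ → Σ ℕ λ r → Σ ℕ λ c →
    r < R × c < C ×
    (∀ i j → S (σ ⟨$⟩ʳ i) (τ ⟨$⟩ʳ j) ≡ blockDiag r c i j)

Triangular : ∀ {R C} → SubsetI R C → Set
Triangular {R} {C} S =
  ∀ (i i′ : Fin R) →
    (∀ j → (i , j) ∈T S → (i′ , j) ∈T S) ⊎ (∀ j → (i′ , j) ∈T S → (i , j) ∈T S)

-- A crossing of S consists of rows i, i′ and columns j, j′ with (i, j), (i′, j′) ∈ S
-- and (i, j′), (i′, j) ∉ S.  Triangular sets are exactly the sets without a
-- crossing, and every occurrence of P or Pᵗ in S or in Sᶜ contains a crossing of S.
-- If S has a crossing but none of the four patterns occurs, every row of S is a copy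
-- or the complement of one fixed row, i.e. S(k, l) = F k xor G l.  Sorting the rows
-- by F and the columns by G displays such an S as a 2 × 2 block diagonal set, and
-- these sets, like their complements (which have the same shape), avoid P and Pᵗ.
module Submission where

open import Defs
open import Data.Nat using (ℕ; suc; zero; _<ᵇ_; _≤ᵇ_; _<_; _<?_)
open import Data.Nat.Properties using (<⇒<ᵇ; ≮⇒≥; <-≤-trans)
open import Data.Fin using (Fin; toℕ) renaming (zero to fzero; suc to fsuc)
open import Data.Fin.Properties using (toℕ<n; any?; all?; ¬∀⟶∃¬)
open import Data.Fin.Permutation
  using (Permutation′; _⟨$⟩ʳ_; _⟨$⟩ˡ_; id; _∘ₚ_; lift₀; transpose; inverseʳ)
open import Data.Bool using (Bool; true; false; not; _∧_; _∨_; _xor_)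
open import Data.Bool.Properties
  using (¬-not; not-involutive; not-injective; not-distribʳ-xor; T-≡) renaming (_≟_ to _≟ᵇ_)
open import Data.Product using (Σ; _×_; _,_; Σ-syntax; ∃-syntax)
open import Data.Sum using (_⊎_; inj₁; inj₂)
open import Relation.Nullary using (¬_; Dec; yes; no; contradiction)
open import Relation.Nullary.Decidable using (_×-dec_; _→-dec_)
open import Relation.Binary.PropositionalEquality
  using (_≡_; _≢_; refl; sym; trans; cong; cong₂; module ≡-Reasoning)
open import Function using (_∘_)
open import Function.Bundles using (_⇔_; mk⇔; Equivalence)

private
  variable
    R C n : ℕ

≡true⇒≢false : ∀ {b} → b ≡ true → b ≢ false
≡true⇒≢false refl ()

not≡true⇒≡false : ∀ {b} → not b ≡ true → b ≡ false
not≡true⇒≡false {false} _ = refl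

not≡false⇒≡true : ∀ {b} → not b ≡ false → b ≡ true
not≡false⇒≡true {true} _ = refl

≢-by-values : ∀ {A : Set} (f : A → Bool) {a b} → f a ≡ true → f b ≡ false → a ≢ b
≢-by-values f fa fb refl = ≡true⇒≢false fa fb

≢-≢⇒≡ : ∀ {a b c : Bool} → a ≢ c → b ≢ c → a ≡ b
≢-≢⇒≡ a≢c b≢c = trans (¬-not a≢c) (sym (¬-not b≢c))

<ᵇ-suc≡not-<ᵇ : ∀ m n → (m <ᵇ suc n) ≡ not (n <ᵇ m)
<ᵇ-suc≡not-<ᵇ zero    n       = refl
<ᵇ-suc≡not-<ᵇ (suc m) zero    = refl
<ᵇ-suc≡not-<ᵇ (suc m) (suc n) = <ᵇ-suc≡not-<ᵇ m n

≤ᵇ≡not-<ᵇ : ∀ m n → (m ≤ᵇ n) ≡ not (n <ᵇ m)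
≤ᵇ≡not-<ᵇ zero    n       = refl
≤ᵇ≡not-<ᵇ (suc m) zero    = refl
≤ᵇ≡not-<ᵇ (suc m) (suc n) = <ᵇ-suc≡not-<ᵇ m n

∧-∨-not≡xor-not : ∀ a b → (a ∧ b) ∨ (not a ∧ not b) ≡ a xor not b
∧-∨-not≡xor-not true  true  = refl
∧-∨-not≡xor-not true  false = refl
∧-∨-not≡xor-not false true  = refl
∧-∨-not≡xor-not false false = refl

PatternFree : SubsetI R C → Set
PatternFree S = ¬ ContainsP S × ¬ ContainsPt S

infix 4 _≗₂_
_≗₂_ : SubsetI R C → SubsetI R C → Set
S ≗₂ T = ∀ i j → S i j ≡ T i j

Crossing : SubsetI R C → Fin R → Fin R → Fin C → Fin C → Set
Crossing S i i′ j j′ = S i j ≡ true × S i j′ ≡ false × S i′ j′ ≡ true × S i′ j ≡ false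

HasCrossing : SubsetI R C → Set
HasCrossing S = ∃[ i ] ∃[ i′ ] ∃[ j ] ∃[ j′ ] Crossing S i i′ j j′

ContainsP⇒HasCrossing : {S : SubsetI R C} → ContainsP S → HasCrossing S
ContainsP⇒HasCrossing (i₁ , i₂ , j₁ , j₂ , _ , _ , _ , _ , _ , a , b , c , d , _) =
  i₁ , i₂ , j₁ , j₂ , a , c , b , d

ContainsPt⇒HasCrossing : {S : SubsetI R C} → ContainsPt S → HasCrossing S
ContainsPt⇒HasCrossing (i₁ , i₂ , _ , j₁ , j₂ , _ , _ , _ , _ , a , b , c , d , _) =
  i₁ , i₂ , j₁ , j₂ , a , c , b , d

Crossing⇒rows≢ : (S : SubsetI R C) → ∀ {i i′ j j′} → Crossing S i i′ j j′ → i ≢ i′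
Crossing⇒rows≢ S {j = j} (a , _ , _ , d) = ≢-by-values (λ k → S k j) a d

HasCrossing-compl : {S : SubsetI R C} → HasCrossing (compl S) → HasCrossing S
HasCrossing-compl (i , i′ , j , j′ , a , b , c , d) =
  i , i′ , j′ , j ,
  not≡false⇒≡true b , not≡true⇒≡false a , not≡false⇒≡true d , not≡true⇒≡false c

¬HasCrossing⇒PatternFree : {S : SubsetI R C} → ¬ HasCrossing S →
                           PatternFree S × PatternFree (compl S)
¬HasCrossing⇒PatternFree ¬cross =
  (¬cross ∘ ContainsP⇒HasCrossing , ¬cross ∘ ContainsPt⇒HasCrossing) ,
  (¬cross ∘ HasCrossing-compl ∘ ContainsP⇒HasCrossing ,
   ¬cross ∘ HasCrossing-compl ∘ ContainsPt⇒HasCrossing)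

Triangular⇒¬HasCrossing : {S : SubsetI R C} → Triangular S → ¬ HasCrossing S
Triangular⇒¬HasCrossing tri (i , i′ , j , j′ , a , b , c , d) with tri i i′
... | inj₁ i⊆i′ = ≡true⇒≢false (i⊆i′ j a) d
... | inj₂ i′⊆i = ≡true⇒≢false (i′⊆i j′ c) b

RowIncluded : SubsetI R C → Fin R → Fin R → Set
RowIncluded S i i′ = ∀ j → (i , j) ∈T S → (i′ , j) ∈T S

rowIncluded? : (S : SubsetI R C) → ∀ i i′ → Dec (RowIncluded S i i′)
rowIncluded? S i i′ = all? λ j → (S i j ≟ᵇ true) →-dec (S i′ j ≟ᵇ true)

¬RowIncluded⇒witness : (S : SubsetI R C) → ∀ {i i′} → ¬ RowIncluded S i i′ →
                       ∃[ j ] S i j ≡ true × S i′ j ≡ false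
¬RowIncluded⇒witness {C = C} S {i} {i′} ¬inc
  with ¬∀⟶∃¬ C _ (λ j → (S i j ≟ᵇ true) →-dec (S i′ j ≟ᵇ true)) ¬inc
... | j , ¬imp with S i j in a | S i′ j in b
...   | true  | false = j , a , b
...   | true  | true  = contradiction (λ _ → refl) ¬imp
...   | false | _     = contradiction (λ ()) ¬imp

¬HasCrossing⇒Triangular : {S : SubsetI R C} → ¬ HasCrossing S → Triangular S
¬HasCrossing⇒Triangular {S = S} ¬cross i i′
  with rowIncluded? S i i′ | rowIncluded? S i′ i
... | yes i⊆i′ | _        = inj₁ i⊆i′
... | no _     | yes i′⊆i = inj₂ i′⊆i
... | no i⊈i′  | no i′⊈i
  with ¬RowIncluded⇒witness S i⊈i′ | ¬RowIncluded⇒witness S i′⊈i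
...   | j , a , d | j′ , c , b = contradiction (i , i′ , j , j′ , a , b , c , d) ¬cross

hasCrossing? : (S : SubsetI R C) → Dec (HasCrossing S)
hasCrossing? S =
  any? λ i → any? λ i′ → any? λ j → any? λ j′ →
    (S i j ≟ᵇ true) ×-dec (S i j′ ≟ᵇ false) ×-dec (S i′ j′ ≟ᵇ true) ×-dec (S i′ j ≟ᵇ false)

Triangular⊎HasCrossing : (S : SubsetI R C) → Triangular S ⊎ HasCrossing S
Triangular⊎HasCrossing S with hasCrossing? S
... | yes cross = inj₂ cross
... | no ¬cross = inj₁ (¬HasCrossing⇒Triangular ¬cross)

infixl 6 _⊕_
_⊕_ : (Fin R → Bool) → (Fin C → Bool) → SubsetI R C
(F ⊕ G) i j = F i xor G j

⊕⇒PatternFree : ∀ {S : SubsetI R C} {F G} → S ≗₂ F ⊕ G → PatternFree S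
⊕⇒PatternFree {S = S} {F} {G} S≗F⊕G = ¬P , ¬Pt
  where
  at : ∀ {i j v} → S i j ≡ v → F i xor G j ≡ v
  at {i} {j} = trans (sym (S≗F⊕G i j))

  ¬P : ¬ ContainsP S
  ¬P (i₁ , i₂ , j₁ , j₂ , j₃ , _ , _ , _ , _ , a , b , c , d , e , f) =
    ≡true⇒≢false (trans (cong (F i₁ xor_) G₂≡G₁) (at a)) (at c)
    where
    G₂≡G₁ : G j₂ ≡ G j₁
    G₂≡G₁ = ≢-≢⇒≡ {c = G j₃} (≢-by-values (F i₂ xor_) (at b) (at f))
                             (≢-by-values (F i₁ xor_) (at a) (at e))

  ¬Pt : ¬ ContainsPt S
  ¬Pt (i₁ , i₂ , i₃ , j₁ , j₂ , _ , _ , _ , _ , a , b , c , d , e , f) =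
    ≡true⇒≢false (trans (cong (_xor G j₁) F₂≡F₁) (at a)) (at d)
    where
    F₂≡F₁ : F i₂ ≡ F i₁
    F₂≡F₁ = ≢-≢⇒≡ {c = F i₃} (≢-by-values (_xor G j₂) (at b) (at f))
                             (≢-by-values (_xor G j₁) (at a) (at e))

compl-⊕ : ∀ {S : SubsetI R C} {F G} → S ≗₂ F ⊕ G → compl S ≗₂ F ⊕ (not ∘ G)
compl-⊕ {F = F} {G} S≗F⊕G i j = trans (cong not (S≗F⊕G i j)) (not-distribʳ-xor (F i) (G j))

blockDiag-⊕ : ∀ r c (i : Fin R) (j : Fin C) → blockDiag r c i j ≡ (toℕ i <ᵇ r) xor (c ≤ᵇ toℕ j)
blockDiag-⊕ r c i j = begin
  (a ∧ b) ∨ ((r ≤ᵇ toℕ i) ∧ (c ≤ᵇ toℕ j))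
    ≡⟨ cong₂ (λ x y → (a ∧ b) ∨ (x ∧ y)) (≤ᵇ≡not-<ᵇ r (toℕ i)) (≤ᵇ≡not-<ᵇ c (toℕ j)) ⟩
  (a ∧ b) ∨ (not a ∧ not b)   ≡⟨ ∧-∨-not≡xor-not a b ⟩
  a xor not b                 ≡⟨ cong (a xor_) (sym (≤ᵇ≡not-<ᵇ c (toℕ j))) ⟩
  a xor (c ≤ᵇ toℕ j)          ∎
  where
  open ≡-Reasoning
  a = toℕ i <ᵇ r
  b = toℕ j <ᵇ c

EquivBlockDiag⇒⊕ : {S : SubsetI R C} → EquivBlockDiag S → ∃[ F ] ∃[ G ] S ≗₂ F ⊕ G
EquivBlockDiag⇒⊕ {S = S} (σ , τ , r , c , _ , _ , S∘στ≡blockDiag) =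
  (λ k → toℕ (σ ⟨$⟩ˡ k) <ᵇ r) , (λ l → c ≤ᵇ toℕ (τ ⟨$⟩ˡ l)) , λ k l → begin
    S k l                                    ≡⟨ sym (cong₂ S (inverseʳ σ) (inverseʳ τ)) ⟩
    S (σ ⟨$⟩ʳ (σ ⟨$⟩ˡ k)) (τ ⟨$⟩ʳ (τ ⟨$⟩ˡ l)) ≡⟨ S∘στ≡blockDiag (σ ⟨$⟩ˡ k) (τ ⟨$⟩ˡ l) ⟩
    blockDiag r c (σ ⟨$⟩ˡ k) (τ ⟨$⟩ˡ l)      ≡⟨ blockDiag-⊕ r c (σ ⟨$⟩ˡ k) (τ ⟨$⟩ˡ l) ⟩
    _                                        ∎
  where open ≡-Reasoning

sortByBool : (f : Fin n → Bool) →
             Σ[ σ ∈ Permutation′ n ] ∃[ r ] ∀ i → f (σ ⟨$⟩ʳ i) ≡ (toℕ i <ᵇ r)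
sortByBool {zero}  f = id , 0 , λ ()
sortByBool {suc n} f with any? (λ k → f k ≟ᵇ true)
... | no ¬∃true = id , 0 , λ i → ¬-not (¬∃true ∘ (i ,_))
... | yes (k , fk) with sortByBool (λ i → f (transpose fzero k ⟨$⟩ʳ fsuc i))
...   | σ , r , fσ = lift₀ σ ∘ₚ transpose fzero k , suc r , λ { fzero → fk ; (fsuc i) → fσ i }

sortedThreshold<n : (f : Fin n → Bool) (σ : Permutation′ n) (r : ℕ) →
                    (∀ i → f (σ ⟨$⟩ʳ i) ≡ (toℕ i <ᵇ r)) → ∀ {x} → f x ≡ false → r < n
sortedThreshold<n {n} f σ r fσ {x} fx with r <? n
... | yes r<n = r<n
... | no r≮n  = contradiction fx (≡true⇒≢false (begin
  f x                         ≡⟨ cong f (sym (inverseʳ σ)) ⟩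
  f (σ ⟨$⟩ʳ (σ ⟨$⟩ˡ x))       ≡⟨ fσ (σ ⟨$⟩ˡ x) ⟩
  toℕ (σ ⟨$⟩ˡ x) <ᵇ r
    ≡⟨ Equivalence.to T-≡ (<⇒<ᵇ (<-≤-trans (toℕ<n (σ ⟨$⟩ˡ x)) (≮⇒≥ r≮n))) ⟩
  true                        ∎))
  where open ≡-Reasoning

⊕⇒EquivBlockDiag : ∀ {S : SubsetI R C} {F G x y} →
                   S ≗₂ F ⊕ G → F x ≡ false → G y ≡ true → EquivBlockDiag S
⊕⇒EquivBlockDiag {S = S} {F} {G} S≗F⊕G Fx Gy with sortByBool F | sortByBool (not ∘ G)
... | σ , r , Fσ | τ , c , notGτ =
  σ , τ , r , c ,
  sortedThreshold<n F σ r Fσ Fx , sortedThreshold<n (not ∘ G) τ c notGτ (cong not Gy) ,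
  λ i j → begin
    S (σ ⟨$⟩ʳ i) (τ ⟨$⟩ʳ j)          ≡⟨ S≗F⊕G (σ ⟨$⟩ʳ i) (τ ⟨$⟩ʳ j) ⟩
    F (σ ⟨$⟩ʳ i) xor G (τ ⟨$⟩ʳ j)    ≡⟨ cong₂ _xor_ (Fσ i) (Gτ j) ⟩
    (toℕ i <ᵇ r) xor (c ≤ᵇ toℕ j)    ≡⟨ sym (blockDiag-⊕ r c i j) ⟩
    blockDiag r c i j                ∎
  where
  open ≡-Reasoning
  Gτ : ∀ j → G (τ ⟨$⟩ʳ j) ≡ (c ≤ᵇ toℕ j)
  Gτ j = begin
    G (τ ⟨$⟩ʳ j)              ≡⟨ sym (not-involutive _) ⟩
    not (not (G (τ ⟨$⟩ʳ j)))  ≡⟨ cong not (notGτ j) ⟩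
    not (toℕ j <ᵇ c)          ≡⟨ sym (≤ᵇ≡not-<ᵇ c (toℕ j)) ⟩
    c ≤ᵇ toℕ j                ∎

module _ {S : SubsetI R C} (¬P : ¬ ContainsP S) (¬Pt : ¬ ContainsPt S)
         (¬Pᶜ : ¬ ContainsP (compl S)) (¬Ptᶜ : ¬ ContainsPt (compl S)) where

  Crossing⇒complementRows : ∀ {i i′ j₁ j₂} → Crossing S i i′ j₁ j₂ → ∀ j → S i′ j ≡ not (S i j)
  Crossing⇒complementRows {i} {i′} {j₁} {j₂} cross@(a , b , c , d) j
    with S i j in e | S i′ j in e′
  ... | true  | false = refl
  ... | false | true  = refl
  ... | true  | true  = contradiction
    (i , i′ , j₂ , j₁ , j , Crossing⇒rows≢ S cross ,
     ≢-by-values (S i′) c d , ≢-by-values (not ∘ S i) (cong not b) (cong not e) ,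
     ≢-by-values (not ∘ S i′) (cong not d) (cong not e′) ,
     cong not b , cong not d , cong not a , cong not c , cong not e , cong not e′) ¬Pᶜ
  ... | false | false = contradiction
    (i , i′ , j₁ , j₂ , j , Crossing⇒rows≢ S cross ,
     ≢-by-values (S i) a b , ≢-by-values (S i) a e , ≢-by-values (S i′) c e′ ,
     a , c , b , d , e , e′) ¬P

  Crossing⇒⊕ : ∀ {i₁ i₂ j₁ j₂} → Crossing S i₁ i₂ j₁ j₂ → S ≗₂ (λ k → S k j₂) ⊕ S i₁
  Crossing⇒⊕ {i₁} {i₂} {j₁} {j₂} cross@(a , b , c , d) k l
    with S k j₁ in e₁ | S k j₂ in e₂
  ... | true  | false = not-injective (trans (sym (Crossing⇒complementRows (e₁ , e₂ , c , d) l))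
                                             (Crossing⇒complementRows cross l))
  ... | false | true  = Crossing⇒complementRows (a , b , e₂ , e₁) l
  ... | true  | true  = contradiction
    (i₁ , i₂ , k , j₂ , j₁ , Crossing⇒rows≢ S cross ,
     ≢-by-values (λ r → not (S r j₂)) (cong not b) (cong not e₂) ,
     ≢-by-values (λ r → not (S r j₁)) (cong not d) (cong not e₁) ,
     ≢-by-values (S i₂) c d ,
     cong not b , cong not d , cong not a , cong not c , cong not e₂ , cong not e₁) ¬Ptᶜ
  ... | false | false = contradiction
    (i₁ , i₂ , k , j₁ , j₂ , Crossing⇒rows≢ S cross ,
     ≢-by-values (λ r → S r j₁) a e₁ , ≢-by-values (λ r → S r j₂) c e₂ , ≢-by-values (S i₁) a b ,
     a , c , b , d , e₁ , e₂) ¬Pt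

PatternFree⇔EquivBlockDiag⊎Triangular : (S : SubsetI R C) →
  (PatternFree S × PatternFree (compl S)) ⇔ (EquivBlockDiag S ⊎ Triangular S)
PatternFree⇔EquivBlockDiag⊎Triangular S = mk⇔ to from
  where
  to : PatternFree S × PatternFree (compl S) → EquivBlockDiag S ⊎ Triangular S
  to ((¬P , ¬Pt) , (¬Pᶜ , ¬Ptᶜ)) with Triangular⊎HasCrossing S
  ... | inj₁ tri = inj₂ tri
  ... | inj₂ (i₁ , _ , _ , j₂ , cross@(a , b , _ , _)) =
    inj₁ (⊕⇒EquivBlockDiag {F = λ k → S k j₂} {G = S i₁}
                            (Crossing⇒⊕ ¬P ¬Pt ¬Pᶜ ¬Ptᶜ cross) b a)

  from : EquivBlockDiag S ⊎ Triangular S → PatternFree S × PatternFree (compl S)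
  from (inj₁ equiv) with EquivBlockDiag⇒⊕ equiv
  ... | F , G , S≗F⊕G =
    ⊕⇒PatternFree {F = F} {G} S≗F⊕G ,
    ⊕⇒PatternFree {F = F} {not ∘ G} (compl-⊕ {F = F} {G} S≗F⊕G)
  from (inj₂ tri) = ¬HasCrossing⇒PatternFree (Triangular⇒¬HasCrossing tri)

proposition2 : ∀ (R′ C′ : ℕ) (S : SubsetI (suc R′) (suc C′)) →
    (Σ (Fin (suc R′) × Fin (suc C′)) λ p → p ∈T S) →
    (Σ (Fin (suc R′) × Fin (suc C′)) λ p → p ∉T S) →
    ((¬ ContainsP S × ¬ ContainsPt S) × (¬ ContainsP (compl S) × ¬ ContainsPt (compl S)))
    ⇔ (EquivBlockDiag S ⊎ Triangular S)
proposition2 R′ C′ S _ _ = PatternFree⇔EquivBlockDiag⊎Triangular S
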